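{- For every fixed integer $q \geq 2$, the function $n \mapsto f(n,q)$ is strictly increasing in $n \geq 1$.
   Context: For integers $n \geq 1$ and $q \geq 2$, let $\mathbb Z_q = \mathbb Z/q\mathbb Z$ and consider $\mathbb Z_q^n$ with the Hamming distance $d(x,y)$ = number of coordinates in which $x$ and $y$ differ. Say $x$ skirts $y$ if $d(x,y) = n$. A set $S \subseteq \mathbb Z_q^n$ is a skirting set if every $y \in \mathbb Z_q^n$ is skirted by some $x \in S$. Let $f(n,q)$ denote the minimum size of a skirting set in $\mathbb Z_q^n$. -}

module Defs where

open import Data.Nat using (ℕ; _≤_; _<_)
open import Data.Fin using (Fin)
open import Data.List using (List; length)
open import Data.List.Membership.Propositional using (_∈_)
open import Data.Product using (∃; _×_)
open import Relation.Binary.PropositionalEquality using (_≡_; _≢_)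

Word : ℕ → ℕ → Set
Word n q = Fin n → Fin q

-- x skirts y : d(x,y) = n, i.e. x and y differ in every coordinate.
Skirts : ∀ {n q} → Word n q → Word n q → Set
Skirts {n} x y = ∀ (i : Fin n) → x i ≢ y i

IsSkirting : ∀ {n q} → List (Word n q) → Set
IsSkirting {n} {q} S = ∀ (y : Word n q) → ∃ λ x → x ∈ S × Skirts x y

-- k = f(n,q): k is the minimum size of a skirting set in ℤ_q^n.
-- (Lists may contain duplicates; this does not affect the minimum.)
IsMinSkirtingSize : ℕ → ℕ → ℕ → Set
IsMinSkirtingSize n q k =
  (∃ λ (S : List (Word n q)) → IsSkirting S × length S ≡ k)
  × (∀ (S : List (Word n q)) → IsSkirting S → k ≤ length S)

module Submission where

-- Deleting the first coordinate of a skirting set in ℤ_q^(n+1) gives a skirting set in ℤ_q^n,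
-- and it stays skirting even after dropping one element x₀ together with every word whose
-- first letter agrees with that of x₀: a target y with y₀ = x₀ 0 can only be skirted by
-- words whose first letter differs from x₀ 0.  So f(n,q) < f(n+1,q).

open import Defs
open import Data.Nat using (ℕ; suc; _≤_; _<_; _<′_; ≤′-refl; ≤′-step; s≤s)
open import Data.Nat.Properties using (<-trans; ≤-<-trans; <⇒<′; module ≤-Reasoning)
open import Data.Fin as Fin using (Fin; zero; _≟_)
open import Data.Vec.Functional using (tail) renaming (_∷_ to _∷ᵥ_)
open import Data.List using (List; []; _∷_; length; map; filter)
open import Data.List.Properties using (length-filter; length-map)
open import Data.List.Membership.Propositional.Properties using (∈-map⁺; ∈-filter⁺)
open import Data.List.Relation.Unary.Any using (here; there)
open import Data.Product using (∃; _×_; _,_)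
open import Relation.Nullary using (¬?; contradiction)
open import Relation.Unary using (Decidable)
open import Relation.Binary.PropositionalEquality using (_≢_; refl)

private
  variable
    n q : ℕ

Skirts-tail : {x y : Word (suc n) q} → Skirts x y → Skirts (tail x) (tail y)
Skirts-tail x-skirts-y i = x-skirts-y (Fin.suc i)

differsAt₀? : (x₀ : Word (suc n) q) → Decidable (λ (x : Word (suc n) q) → x zero ≢ x₀ zero)
differsAt₀? x₀ x = ¬? (x zero ≟ x₀ zero)

puncture : Word (suc n) q → List (Word (suc n) q) → List (Word n q)
puncture x₀ S = map tail (filter (differsAt₀? x₀) S)

length-puncture : (x₀ : Word (suc n) q) (S : List (Word (suc n) q))
                → length (puncture x₀ S) ≤ length S
length-puncture x₀ S = begin
  length (map tail (filter (differsAt₀? x₀) S)) ≡⟨ length-map tail (filter (differsAt₀? x₀) S) ⟩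
  length (filter (differsAt₀? x₀) S)            ≤⟨ length-filter (differsAt₀? x₀) S ⟩
  length S                                      ∎
  where open ≤-Reasoning

IsSkirting-puncture : (x₀ : Word (suc n) q) (S : List (Word (suc n) q))
                    → IsSkirting (x₀ ∷ S) → IsSkirting (puncture x₀ S)
IsSkirting-puncture x₀ S skirting y with skirting (x₀ zero ∷ᵥ y)
... | x , here refl , x-skirts = contradiction refl (x-skirts zero)
... | x , there x∈S , x-skirts =
  tail x , ∈-map⁺ tail (∈-filter⁺ (differsAt₀? x₀) x∈S (x-skirts zero)) , Skirts-tail x-skirts

SmallerSkirting : ∀ m → List (Word n q) → Set
SmallerSkirting {q = q} m S = ∃ λ (T : List (Word m q)) → IsSkirting T × length T < length S

skirting-shrink : Fin q → (S : List (Word (suc n) q)) → IsSkirting S → SmallerSkirting n S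
skirting-shrink c []       skirting with skirting (λ _ → c)
... | _ , () , _
skirting-shrink c (x₀ ∷ S) skirting =
  puncture x₀ S , IsSkirting-puncture x₀ S skirting , s≤s (length-puncture x₀ S)

skirting-shrink′ : ∀ {m} → Fin q → n <′ m
                 → (S : List (Word m q)) → IsSkirting S → SmallerSkirting n S
skirting-shrink′ c ≤′-refl        S skirting = skirting-shrink c S skirting
skirting-shrink′ c (≤′-step n<′m) S skirting with skirting-shrink c S skirting
... | T , T-skirting , T<S with skirting-shrink′ c n<′m T T-skirting
...   | U , U-skirting , U<T = U , U-skirting , <-trans U<T T<S

lemma3p3 : ∀ (q : ℕ) → 2 ≤ q → ∀ (n m k l : ℕ) → 1 ≤ n → n < m
           → IsMinSkirtingSize n q k → IsMinSkirtingSize m q l → k < l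
lemma3p3 (suc q) _ n m k l _ n<m (_ , k-minimal) ((S , S-skirting , refl) , _)
  with skirting-shrink′ zero (<⇒<′ n<m) S S-skirting
... | T , T-skirting , T<S = ≤-<-trans (k-minimal T T-skirting) T<S
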